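{- Let $d$ be a positive integer and let $r$ and $k$ be positive integers with $1 \leq k \leq r/2$. Then $\sigma(\mathbb{Z}^{\boxtimes d},r,k) \leq r-2k+2$.
   Context: Graphs are simple and undirected and may be infinite. For a graph $G$ and positive integers $r,s,k$, the game "Revolutionaries and Spies" $\mathcal{G}(G,r,s,k)$ is played between a team of $r$ revolutionaries and a team of $s$ spies with perfect information. In round $0$, each revolutionary chooses a vertex of $G$ as its position, and then each spy does the same; any number of agents may occupy the same vertex at any time. In each round $i \ge 1$, first every revolutionary simultaneously either stays at its vertex or moves to an adjacent vertex, and then every spy does the same. A meeting of size $k$ at a vertex $v$ means at least $k$ revolutionaries are at $v$; it is guarded if at least one spy is at $v$. The revolutionaries win if at the end of some round (after the spies have moved in that round) there is an unguarded meeting of size $k$; otherwise the spies win. $\sigma(G,r,k)$ denotes the minimum positive integer $s$ such that the spies have a winning strategy in $\mathcal{G}(G,r,s,k)$. $\mathbb{Z}^{\boxtimes d}$ is the graph with vertex set $\mathbb{Z}^d$ in which distinct $a,b$ are adjacent iff $|a_i-b_i|\le 1$ for all $1\le i\le d$ (the $d$-fold strong product of the path graph on $\mathbb{Z}$ with itself). -}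

module Defs where

open import Data.Nat using (ℕ; suc; _≤_; _∸_; _+_; _*_)
open import Data.Integer as ℤ using (ℤ; ∣_∣)
open import Data.Fin using (Fin; toℕ)
open import Data.Vec using (Vec; lookup)
open import Data.Vec.Properties using (≡-dec)
open import Data.List using (List; length; filter; allFin)
open import Data.List.Base using ()
open import Data.Fin.Base using ()
open import Data.Fin.Properties using ()
open import Data.Product using (Σ; ∃; _×_)
open import Relation.Binary.PropositionalEquality using (_≡_)
open import Relation.Nullary using (Dec)

Vertex : ℕ → Set
Vertex d = Vec ℤ d

-- a and b are equal or adjacent in the strong product Z^{⊠d}
-- (|a_i - b_i| ≤ 1 for all coordinates i): the allowed "stay or move" relation.
Near : {d : ℕ} → Vertex d → Vertex d → Set
Near {d} a b = (i : Fin d) → ∣ lookup a i ℤ.- lookup b i ∣ ≤ 1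

_≟V_ : {d : ℕ} → (a b : Vertex d) → Dec (a ≡ b)
_≟V_ = ≡-dec ℤ._≟_

Positions : ℕ → ℕ → Set
Positions d m = Fin m → Vertex d

countAt : {d m : ℕ} → Positions d m → Vertex d → ℕ
countAt {m = m} P v = length (filter (λ i → P i ≟V v) (allFin m))

LegalRevPlay : (d r : ℕ) → (ℕ → Positions d r) → Set
LegalRevPlay d r R = (n : ℕ) (i : Fin r) → Near (R n i) (R (suc n) i)

-- A (deterministic, perfect-information) spy strategy: at round n the spies
-- see the revolutionaries' positions in rounds 0..n (the spies' own previous
-- positions are determined by these via the strategy) and choose positions.
-- Round 0 gives the initial placement.
SpyStrategy : (d r s : ℕ) → Set
SpyStrategy d r s = (n : ℕ) → (Fin (suc n) → Positions d r) → Positions d s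

spyPlay : {d r s : ℕ} → SpyStrategy d r s → (ℕ → Positions d r) → ℕ → Positions d s
spyPlay σ R n = σ n (λ j → R (toℕ j))

WinningSpyStrategy : (d r s k : ℕ) → SpyStrategy d r s → Set
WinningSpyStrategy d r s k σ =
  (R : ℕ → Positions d r) → LegalRevPlay d r R →
    ((n : ℕ) (j : Fin s) → Near (spyPlay σ R n j) (spyPlay σ R (suc n) j))
    × ((n : ℕ) (v : Vertex d) → k ≤ countAt (R n) v →
        ∃ λ (j : Fin s) → spyPlay σ R n j ≡ v)

SpiesWin : (d r s k : ℕ) → Set
SpiesWin d r s k = Σ (SpyStrategy d r s) (WinningSpyStrategy d r s k)

-- σ(Z^{⊠d}, r, k) ≤ m  (σ is the least positive s with SpiesWin)
SigmaLe : (d r k m : ℕ) → Set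
SigmaLe d r k m = ∃ λ s → 1 ≤ s × s ≤ m × SpiesWin d r s k

module Submission where

-- Write k = h + 1 and r = m + a, where m = 2h + 1 = 2k - 1. The first m
-- revolutionaries are "main", the last a are "extra". Spy 0 always stands at
-- the coordinatewise median of the main revolutionaries; spy j + 1 shadows
-- extra revolutionary j. That is a + 1 ≤ r - 2k + 2 spies.
--  * Legality: a median of 2h+1 integers moves by at most one when every
--    integer does, so the median spy moves like a king in Z^{⊠d}.
--  * Guarding: a meeting of k revolutionaries either contains an extra one,
--    whose shadow is present, or consists of k = h + 1 main revolutionaries,
--    a strict majority of the main ones, which forces every coordinatewise
--    median to equal that coordinate of the meeting vertex.

open import Defs
open import Level using (0ℓ)
open import Data.Nat as ℕ using (ℕ; zero; suc; z≤n; s≤s)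
import Data.Nat.Properties as ℕP
open import Data.Integer as ℤ using (ℤ; +_; -[1+_]; ∣_∣; -_; 1ℤ; +≤+; -≤+)
import Data.Integer.Properties as ℤP
open import Data.Integer.Tactic.RingSolver using (solve-∀)
open import Data.Nat.Tactic.RingSolver using () renaming (solve-∀ to ℕ-solve-∀)
open import Data.Fin as Fin using (Fin; _↑ˡ_; _↑ʳ_; fromℕ)
import Data.Fin.Properties as FinP
open import Data.List using (List; []; _∷_; _++_; length; filter; tabulate; allFin)
open import Data.List.Properties using (filter-++; length-++; length-tabulate; filter-all; filter-none)
open import Data.List.Relation.Unary.All as All using (All; []; _∷_)
open import Data.List.Relation.Unary.All.Properties using (tabulate⁺)
open import Data.List.Relation.Binary.Sublist.Propositional using (⊆-refl)
open import Data.List.Relation.Binary.Sublist.Heterogeneous.Properties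
  using (length-mono-≤; ⊆-filter-Sublist)
open import Data.Vec as Vec using (lookup)
open import Data.Vec.Properties using (lookup∘tabulate; tabulate∘lookup; tabulate-cong)
open import Data.Product using (∃; _×_; _,_; proj₁; proj₂)
open import Data.Sum using (_⊎_; inj₁; inj₂)
open import Data.Empty using (⊥; ⊥-elim)
open import Function using (_∘_; id)
open import Relation.Nullary using (Dec; yes; no; ¬_)
open import Relation.Unary using (Pred; Decidable; _⊆_; ∁)
open import Relation.Unary.Properties using (∁?)
open import Relation.Binary.PropositionalEquality

count : {A : Set} {P : Pred A 0ℓ} → Decidable P → List A → ℕ
count P? xs = length (filter P? xs)

count-complement : {A : Set} {P : Pred A 0ℓ} (P? : Decidable P) (xs : List A) →
  count P? xs ℕ.+ count (∁? P?) xs ≡ length xs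
count-complement P? [] = refl
count-complement P? (x ∷ xs) with P? x
... | yes _ = cong suc (count-complement P? xs)
... | no _  = trans (ℕP.+-suc _ _) (cong suc (count-complement P? xs))

module _ {A : Set} {P Q : Pred A 0ℓ} (P? : Decidable P) (Q? : Decidable Q) where

  count-mono : P ⊆ Q → (xs : List A) → count P? xs ℕ.≤ count Q? xs
  count-mono P⊆Q xs =
    length-mono-≤ (⊆-filter-Sublist P? Q? (λ { refl → P⊆Q }) (⊆-refl {x = xs}))

module _ {A : Set} {P Q : Pred A 0ℓ} (P? : Decidable P) (Q? : Decidable Q) where

  count-disjoint : (∀ x → P x → Q x → ⊥) → (xs : List A) →
    count P? xs ℕ.+ count Q? xs ℕ.≤ length xs
  count-disjoint disjoint xs = begin
    count P? xs ℕ.+ count Q? xs      ≤⟨ ℕP.+-monoʳ-≤ (count P? xs)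
                                          (count-mono Q? (∁? P?) (λ {x} q p → disjoint x p q) xs) ⟩
    count P? xs ℕ.+ count (∁? P?) xs ≡⟨ count-complement P? xs ⟩
    length xs                        ∎
    where open ℕP.≤-Reasoning

  count-cover : (∀ x → P x ⊎ Q x) → (xs : List A) →
    length xs ℕ.≤ count P? xs ℕ.+ count Q? xs
  count-cover cover xs = begin
    length xs                        ≡⟨ count-complement P? xs ⟨
    count P? xs ℕ.+ count (∁? P?) xs ≤⟨ ℕP.+-monoʳ-≤ (count P? xs) (count-mono (∁? P?) Q? notP⇒Q xs) ⟩
    count P? xs ℕ.+ count Q? xs      ∎
    where
    open ℕP.≤-Reasoning
    notP⇒Q : ∁ P ⊆ Q
    notP⇒Q {x} ¬p with cover x
    ... | inj₁ p = ⊥-elim (¬p p)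
    ... | inj₂ q = q

count-++ : {A : Set} {P : Pred A 0ℓ} (P? : Decidable P) (xs ys : List A) →
  count P? (xs ++ ys) ≡ count P? xs ℕ.+ count P? ys
count-++ P? xs ys = trans (cong length (filter-++ P? xs ys)) (length-++ (filter P? xs))

allFin-+ : (m n : ℕ) → allFin (m ℕ.+ n) ≡ tabulate (_↑ˡ n) ++ tabulate (m ↑ʳ_)
allFin-+ m n = tabulate-+ m id
  where
  tabulate-+ : {B : Set} (m : ℕ) (g : Fin (m ℕ.+ n) → B) →
    tabulate g ≡ tabulate (g ∘ (_↑ˡ n)) ++ tabulate (g ∘ (m ↑ʳ_))
  tabulate-+ zero    g = refl
  tabulate-+ (suc m) g = cong (g Fin.zero ∷_) (tabulate-+ m (g ∘ Fin.suc))

≤-abs : (z : ℤ) → z ℤ.≤ + ∣ z ∣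
≤-abs (+ n)    = ℤP.≤-refl
≤-abs -[1+ n ] = -≤+

abs≤⇒bounded : (z : ℤ) (n : ℕ) → ∣ z ∣ ℕ.≤ n → - + n ℤ.≤ z × z ℤ.≤ + n
abs≤⇒bounded z n small = lower , ℤP.≤-trans (≤-abs z) (+≤+ small)
  where
  lower : - + n ℤ.≤ z
  lower = subst (- + n ℤ.≤_) (ℤP.neg-involutive z)
            (ℤP.neg-mono-≤ (ℤP.≤-trans (≤-abs (- z)) (+≤+ (subst (ℕ._≤ n) (sym (ℤP.∣-i∣≡∣i∣ z)) small))))

sub-add : (a b : ℤ) → a ≡ a ℤ.- b ℤ.+ b
sub-add = solve-∀

dist≤1⇒≤suc : (a b : ℤ) → ∣ a ℤ.- b ∣ ℕ.≤ 1 → a ℤ.≤ ℤ.suc b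
dist≤1⇒≤suc a b close = begin
  a               ≡⟨ sub-add a b ⟩
  a ℤ.- b ℤ.+ b   ≤⟨ ℤP.+-monoˡ-≤ b (ℤP.≤-trans (≤-abs (a ℤ.- b)) (+≤+ close)) ⟩
  1ℤ ℤ.+ b        ∎
  where open ℤP.≤-Reasoning

succ-sub : (a : ℤ) → 1ℤ ℤ.+ a ℤ.- a ≡ 1ℤ
succ-sub = solve-∀

between⇒dist≤1 : (a b : ℤ) → a ℤ.≤ b → b ℤ.≤ ℤ.suc a → ∣ a ℤ.- b ∣ ℕ.≤ 1
between⇒dist≤1 a b a≤b b≤a+1 = ℤP.drop‿+≤+ (begin
  + ∣ a ℤ.- b ∣    ≡⟨ ℤP.∣-∣-≤ a≤b ⟩
  b ℤ.- a          ≤⟨ ℤP.+-monoˡ-≤ (- a) b≤a+1 ⟩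
  ℤ.suc a ℤ.- a    ≡⟨ succ-sub a ⟩
  1ℤ               ∎)
  where open ℤP.≤-Reasoning

≤suc⇒dist≤1 : (a b : ℤ) → a ℤ.≤ ℤ.suc b → b ℤ.≤ ℤ.suc a → ∣ a ℤ.- b ∣ ℕ.≤ 1
≤suc⇒dist≤1 a b a≤b+1 b≤a+1 with ℤP.≤-total a b
... | inj₁ a≤b = between⇒dist≤1 a b a≤b b≤a+1
... | inj₂ b≤a = subst (ℕ._≤ 1) (ℤP.∣i-j∣≡∣j-i∣ b a) (between⇒dist≤1 b a b≤a a≤b+1)

step-forward : (c x : ℤ) → c ℤ.+ (1ℤ ℤ.+ x) ≡ (1ℤ ℤ.+ c) ℤ.+ x
step-forward = solve-∀

climb : {P Q : Pred ℤ 0ℓ} → Decidable P → (∀ c → Q c → ¬ P c → Q (ℤ.suc c)) →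
  (n : ℕ) (c : ℤ) → Q c → P (c ℤ.+ + n) → ∃ λ c → P c × Q c
climb {P} P? step zero c q p = c , subst P (ℤP.+-identityʳ c) p , q
climb {P} P? step (suc n) c q p with P? c
... | yes pc = c , pc , q
... | no ¬pc = climb P? step n (ℤ.suc c) (step c q ¬pc)
                 (subst P (trans (cong (λ x → c ℤ.+ x) (ℤP.pos-+ 1 n)) (step-forward c (+ n))) p)

bounded : {A : Set} (f : A → ℤ) (xs : List A) → ∃ λ B → All (λ x → ∣ f x ∣ ℕ.≤ B) xs
bounded f []       = 0 , []
bounded f (x ∷ xs) with B , below ← bounded f xs =
  ∣ f x ∣ ℕ.+ B , ℕP.m≤m+n _ B ∷ All.map (λ le → ℕP.≤-trans le (ℕP.m≤n+m B _)) below

neg-double : (x : ℤ) → - x ℤ.+ (x ℤ.+ x) ≡ x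
neg-double = solve-∀

module Median {A : Set} (xs : List A) (h : ℕ) (odd : length xs ≡ suc h ℕ.+ h) where

  atMost atLeast : (A → ℤ) → ℤ → ℕ
  atMost  f c = count (λ x → f x ℤ.≤? c) xs
  atLeast f c = count (λ x → c ℤ.≤? f x) xs

  IsMedian : (A → ℤ) → ℤ → Set
  IsMedian f c = suc h ℕ.≤ atMost f c × suc h ℕ.≤ atLeast f c

  majorities-meet : {P Q : Pred A 0ℓ} (P? : Decidable P) (Q? : Decidable Q) →
    suc h ℕ.≤ count P? xs → suc h ℕ.≤ count Q? xs → ¬ (∀ x → P x → Q x → ⊥)
  majorities-meet P? Q? bigP bigQ disjoint =
    ℕP.<-irrefl refl (ℕP.+-cancelˡ-≤ (suc h) (suc h) h (begin
      suc h ℕ.+ suc h                ≤⟨ ℕP.+-mono-≤ bigP bigQ ⟩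
      count P? xs ℕ.+ count Q? xs    ≤⟨ count-disjoint P? Q? disjoint xs ⟩
      length xs                      ≡⟨ odd ⟩
      suc h ℕ.+ h                    ∎))
    where open ℕP.≤-Reasoning

  -- Every family has a median: search upward for the least c with a majority
  -- at most c, keeping a majority at least c, from -B up to B where all
  -- values lie in [-B, B].
  median-exists : (f : A → ℤ) → ∃ (IsMedian f)
  median-exists f =
    climb (λ c → suc h ℕ.≤? atMost f c) step (B ℕ.+ B) (- + B) start stop
    where
    B : ℕ
    B = proj₁ (bounded f xs)
    inRange : All (λ x → - + B ℤ.≤ f x × f x ℤ.≤ + B) xs
    inRange = All.map (λ {x} → abs≤⇒bounded (f x) B) (proj₂ (bounded f xs))
    majority : suc h ℕ.≤ length xs
    majority = ℕP.≤-trans (ℕP.m≤m+n (suc h) h) (ℕP.≤-reflexive (sym odd))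
    start : suc h ℕ.≤ atLeast f (- + B)
    start = subst (suc h ℕ.≤_) (sym (cong length (filter-all _ (All.map proj₁ inRange)))) majority
    stop : suc h ℕ.≤ atMost f (- + B ℤ.+ + (B ℕ.+ B))
    stop = subst (λ c → suc h ℕ.≤ atMost f c)
             (sym (trans (cong (λ x → - + B ℤ.+ x) (ℤP.pos-+ B B)) (neg-double (+ B))))
             (subst (suc h ℕ.≤_) (sym (cong length (filter-all _ (All.map proj₂ inRange)))) majority)
    step : ∀ c → suc h ℕ.≤ atLeast f c → ¬ suc h ℕ.≤ atMost f c → suc h ℕ.≤ atLeast f (ℤ.suc c)
    step c _ few = ℕP.+-cancelˡ-≤ h (suc h) (atLeast f (ℤ.suc c)) (begin
      h ℕ.+ suc h                                ≡⟨ ℕP.+-comm h (suc h) ⟩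
      suc h ℕ.+ h                                ≡⟨ odd ⟨
      length xs                                  ≤⟨ count-cover _ _ below-or-above xs ⟩
      atMost f c ℕ.+ atLeast f (ℤ.suc c)         ≤⟨ ℕP.+-monoˡ-≤ _ (ℕP.≤-pred (ℕP.≰⇒> few)) ⟩
      h ℕ.+ atLeast f (ℤ.suc c)                  ∎)
      where
      open ℕP.≤-Reasoning
      below-or-above : ∀ x → f x ℤ.≤ c ⊎ ℤ.suc c ℤ.≤ f x
      below-or-above x with f x ℤ.≤? c
      ... | yes fx≤c = inj₁ fx≤c
      ... | no  fx≰c = inj₂ (ℤP.i<j⇒suc[i]≤j (ℤP.≰⇒> fx≰c))

  median : (A → ℤ) → ℤ
  median f = proj₁ (median-exists f)

  median-isMedian : (f : A → ℤ) → IsMedian f (median f)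
  median-isMedian f = proj₂ (median-exists f)

  -- If g exceeds f by at most one everywhere, any median of g exceeds any
  -- median of f by at most one: otherwise {f ≤ c} and {g ≥ c'} would be
  -- disjoint majorities.
  median-step : (f g : A → ℤ) → (∀ x → g x ℤ.≤ ℤ.suc (f x)) →
    ∀ {c c'} → IsMedian f c → IsMedian g c' → c' ℤ.≤ ℤ.suc c
  median-step f g g≤f+1 {c} {c'} (lowF , _) (_ , highG) = ℤP.≮⇒≥ λ c+1<c' →
    majorities-meet (λ x → f x ℤ.≤? c) (λ x → c' ℤ.≤? g x) lowF highG λ x fx≤c c'≤gx →
      ℤP.<-irrefl refl (ℤP.<-≤-trans c+1<c'
        (ℤP.≤-trans c'≤gx (ℤP.≤-trans (g≤f+1 x) (ℤP.suc-mono fx≤c))))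

  median-near : (f g : A → ℤ) → (∀ x → ∣ f x ℤ.- g x ∣ ℕ.≤ 1) →
    ∣ median f ℤ.- median g ∣ ℕ.≤ 1
  median-near f g near = ≤suc⇒dist≤1 (median f) (median g)
    (median-step g f (λ x → dist≤1⇒≤suc (f x) (g x) (near x)) (median-isMedian g) (median-isMedian f))
    (median-step f g (λ x → dist≤1⇒≤suc (g x) (f x) (near′ x)) (median-isMedian f) (median-isMedian g))
    where
    near′ : ∀ x → ∣ g x ℤ.- f x ∣ ℕ.≤ 1
    near′ x = subst (ℕ._≤ 1) (ℤP.∣i-j∣≡∣j-i∣ (f x) (g x)) (near x)

  -- A value taken by a majority is the median: on either side of a different
  -- c, the majority at v would be disjoint from one of the median's majorities.
  median-majority : (f : A → ℤ) (v : ℤ) → suc h ℕ.≤ count (λ x → f x ℤ.≟ v) xs → median f ≡ v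
  median-majority f v bigV = ℤP.≤-antisym c≤v v≤c
    where
    c : ℤ
    c = median f
    c≤v : c ℤ.≤ v
    c≤v = ℤP.≮⇒≥ λ v<c → majorities-meet (λ x → c ℤ.≤? f x) (λ x → f x ℤ.≟ v)
      (proj₂ (median-isMedian f)) bigV λ x c≤fx fx≡v →
        ℤP.<-irrefl refl (ℤP.<-≤-trans v<c (subst (c ℤ.≤_) fx≡v c≤fx))
    v≤c : v ℤ.≤ c
    v≤c = ℤP.≮⇒≥ λ c<v → majorities-meet (λ x → f x ℤ.≤? c) (λ x → f x ℤ.≟ v)
      (proj₁ (median-isMedian f)) bigV λ x fx≤c fx≡v →
        ℤP.<-irrefl refl (ℤP.<-≤-trans c<v (subst (ℤ._≤ c) fx≡v fx≤c))

module Strategy (d h a : ℕ) where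

  m : ℕ
  m = suc h ℕ.+ h

  r : ℕ
  r = m ℕ.+ a

  mainRevs : List (Fin r)
  mainRevs = tabulate (_↑ˡ a)

  open Median mainRevs h (length-tabulate (_↑ˡ a))

  coordinate : Positions d r → Fin d → Fin r → ℤ
  coordinate P ι i = lookup (P i) ι

  medianVertex : Positions d r → Vertex d
  medianVertex P = Vec.tabulate (λ ι → median (coordinate P ι))

  spyPositions : Positions d r → Positions d (suc a)
  spyPositions P Fin.zero    = medianVertex P
  spyPositions P (Fin.suc j) = P (m ↑ʳ j)

  strategy : SpyStrategy d r (suc a)
  strategy n history = spyPositions (history (fromℕ n))

  strategy-current : (R : ℕ → Positions d r) (n : ℕ) (j : Fin (suc a)) →
    spyPlay strategy R n j ≡ spyPositions (R n) j
  strategy-current R n j = cong (λ t → spyPositions (R t) j) (FinP.toℕ-fromℕ n)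

  -- When every revolutionary makes a legal move, so does every spy: the
  -- shadows copy a move, and each median coordinate changes by at most one.
  spies-move : (P Q : Positions d r) → (∀ i → Near (P i) (Q i)) →
    ∀ j → Near (spyPositions P j) (spyPositions Q j)
  spies-move P Q moves (Fin.suc j) = moves (m ↑ʳ j)
  spies-move P Q moves Fin.zero ι =
    subst₂ (λ x y → ∣ x ℤ.- y ∣ ℕ.≤ 1) (sym (lookup∘tabulate _ ι)) (sym (lookup∘tabulate _ ι))
      (median-near (coordinate P ι) (coordinate Q ι) (λ i → moves i ι))

  main-meeting : (P : Positions d r) (v : Vertex d) → (∀ j → P (m ↑ʳ j) ≢ v) →
    countAt P v ≡ count (λ i → P i ≟V v) mainRevs
  main-meeting P v noExtra = begin
    countAt P v                                   ≡⟨ cong (count atV?) (allFin-+ m a) ⟩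
    count atV? (mainRevs ++ extraRevs)            ≡⟨ count-++ atV? mainRevs extraRevs ⟩
    count atV? mainRevs ℕ.+ count atV? extraRevs  ≡⟨ cong (count atV? mainRevs ℕ.+_) noneAtV ⟩
    count atV? mainRevs ℕ.+ 0                     ≡⟨ ℕP.+-identityʳ _ ⟩
    count atV? mainRevs                           ∎
    where
    open ≡-Reasoning
    atV? : (i : Fin r) → Dec (P i ≡ v)
    atV? i = P i ≟V v
    extraRevs : List (Fin r)
    extraRevs = tabulate (m ↑ʳ_)
    noneAtV : count atV? extraRevs ≡ 0
    noneAtV = cong length (filter-none atV? (tabulate⁺ noExtra))

  -- Every meeting of h + 1 revolutionaries is guarded: by a shadow if an extra
  -- revolutionary attends, and otherwise by the median spy, since h + 1 main
  -- revolutionaries are a majority fixing every median coordinate.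
  meetings-guarded : (P : Positions d r) (v : Vertex d) → suc h ℕ.≤ countAt P v →
    ∃ λ j → spyPositions P j ≡ v
  meetings-guarded P v meeting with FinP.any? (λ j → P (m ↑ʳ j) ≟V v)
  ... | yes (j , extraAtV) = Fin.suc j , extraAtV
  ... | no noExtra = Fin.zero , (begin
    medianVertex P              ≡⟨ tabulate-cong median-at ⟩
    Vec.tabulate (lookup v)     ≡⟨ tabulate∘lookup v ⟩
    v                           ∎)
    where
    open ≡-Reasoning
    median-at : ∀ ι → median (coordinate P ι) ≡ lookup v ι
    median-at ι = median-majority (coordinate P ι) (lookup v ι)
      (ℕP.≤-trans (ℕP.≤-trans meeting (ℕP.≤-reflexive (main-meeting P v (λ j atV → noExtra (j , atV)))))
        (count-mono (λ i → P i ≟V v) (λ i → coordinate P ι i ℤ.≟ lookup v ι)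
          (cong (λ w → lookup w ι)) mainRevs))

  winning : WinningSpyStrategy d r (suc a) (suc h) strategy
  winning R legal = spies-legal , guarded
    where
    spies-legal : (n : ℕ) (j : Fin (suc a)) → Near (spyPlay strategy R n j) (spyPlay strategy R (suc n) j)
    spies-legal n j = subst₂ Near (sym (strategy-current R n j)) (sym (strategy-current R (suc n) j))
      (spies-move (R n) (R (suc n)) (legal n) j)
    guarded : (n : ℕ) (v : Vertex d) → suc h ℕ.≤ countAt (R n) v → ∃ λ j → spyPlay strategy R n j ≡ v
    guarded n v meeting with j , guard ← meetings-guarded (R n) v meeting =
      j , trans (strategy-current R n j) guard

twice-suc : (h : ℕ) → 2 ℕ.* suc h ≡ suc (suc h ℕ.+ h)
twice-suc = ℕ-solve-∀

spy-count : (m a : ℕ) → suc a ℕ.≤ (m ℕ.+ a) ℕ.∸ suc m ℕ.+ 2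
spy-count zero    zero    = s≤s z≤n
spy-count zero    (suc a) = ℕP.≤-reflexive (ℕP.+-comm 2 a)
spy-count (suc m) a       = spy-count m a

main≤ : (h r : ℕ) → 2 ℕ.* suc h ℕ.≤ r → suc h ℕ.+ h ℕ.≤ r
main≤ h r 2k≤r = ℕP.≤-trans (ℕP.n≤1+n _) (subst (ℕ._≤ r) (twice-suc h) 2k≤r)

spies-enough : (h a : ℕ) → suc a ℕ.≤ (suc h ℕ.+ h ℕ.+ a) ℕ.∸ 2 ℕ.* suc h ℕ.+ 2
spies-enough h a = subst (λ t → suc a ℕ.≤ (suc h ℕ.+ h ℕ.+ a) ℕ.∸ t ℕ.+ 2)
  (sym (twice-suc h)) (spy-count (suc h ℕ.+ h) a)

mainTheorem8 : (d r k : ℕ) → 1 ℕ.≤ d → 1 ℕ.≤ r → 1 ℕ.≤ k → 2 ℕ.* k ℕ.≤ r →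
    SigmaLe d r k ((r ℕ.∸ 2 ℕ.* k) ℕ.+ 2)
mainTheorem8 d r (suc h) _ _ _ 2k≤r with ℕP.m≤n⇒∃[o]m+o≡n (main≤ h r 2k≤r)
... | a , refl =
  suc a , s≤s z≤n , spies-enough h a , Strategy.strategy d h a , Strategy.winning d h a
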